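{- Let $G=(V,E)$ be a graph with $n=|V|$ vertices, and let $X=\{X_1,\dots,X_{|X|}\}$ be a valid coloring of $G$ with $|X|$ colors, where $X_i$ is the set of vertices receiving color $i$, and let $\Sigma(X)=\sum_{i=1}^{|X|} i\,|X_i|$. Then the chromatic strength of $G$ satisfies $$ s(G)\le \max\left(\left\lceil \frac{1+\sqrt{1+8(\Sigma(X)-n)}}{2}\right\rceil-1,\ |X|\right).$$
   Context: A coloring of $G$ with $k$ colors is a map $c:V\to\{1,\dots,k\}$; it is valid if $c(u)\ne c(v)$ for every edge $(u,v)\in E$. Color $i$ has weight $i$, and the sum of a coloring $X=\{X_1,\dots,X_k\}$ (with $X_i=c^{ -1}(i)$) is $\Sigma(X)=\sum_{i=1}^k i|X_i|$. The chromatic sum $\Sigma(G)$ is the minimum of $\Sigma(X)$ over all valid colorings $X$ of $G$. The chromatic strength $s(G)$ is the minimum number of colors used by a valid coloring $X$ of $G$ with $\Sigma(X)=\Sigma(G)$. -}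

module Defs where

open import Data.Nat using (ℕ; zero; suc; _+_; _*_; _∸_; _≤_; _≤?_; _⊔_)
open import Data.Nat.DivMod using (_/_)
open import Data.Fin as Fin using (Fin; toℕ)
open import Data.List using (List; length; filter; allFin; foldr; map)
open import Relation.Nullary using (¬_; yes; no)
open import Relation.Binary.PropositionalEquality using (_≡_)
open import Data.Product using (Σ; _×_; ∃)

record Graph : Set₁ where
  field
    n : ℕ
    E : Fin n → Fin n → Set
open Graph public

-- A coloring of G with k colors: c : V → Fin k, where Fin-index i stands
-- for colour i+1 ∈ {1,…,k}.
Coloring : Graph → ℕ → Set
Coloring G k = Fin (n G) → Fin k

Valid : (G : Graph) {k : ℕ} → Coloring G k → Set
Valid G c = ∀ u v → E G u v → ¬ (c u ≡ c v)

classSize : (G : Graph) {k : ℕ} → Coloring G k → Fin k → ℕ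
classSize G c i = length (filter (λ v → c v Fin.≟ i) (allFin (n G)))

colorSum : (G : Graph) {k : ℕ} → Coloring G k → ℕ
colorSum G {k} c = foldr _+_ 0 (map (λ i → suc (toℕ i) * classSize G c i) (allFin k))

Optimal : (G : Graph) {k : ℕ} → Coloring G k → Set
Optimal G c = Valid G c ×
  (∀ (k' : ℕ) (c' : Coloring G k') → Valid G c' → colorSum G c ≤ colorSum G c')

IsChromaticStrength : Graph → ℕ → Set
IsChromaticStrength G s =
  (Σ (Coloring G s) λ c → Optimal G c) ×
  (∀ (k : ℕ) (c : Coloring G k) → Optimal G c → s ≤ k)

ceilSqrtFrom : ℕ → ℕ → ℕ → ℕ
ceilSqrtFrom N r zero = r
ceilSqrtFrom N r (suc f) with N ≤? r * r
... | yes _ = r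
... | no _ = ceilSqrtFrom N (suc r) f

ceilSqrt : ℕ → ℕ
ceilSqrt N = ceilSqrtFrom N 0 N

-- ⌈(1 + √N) / 2⌉ = ⌈(1 + ⌈√N⌉) / 2⌉ = ⌊(2 + ⌈√N⌉) / 2⌋.
ceilHalfOnePlusSqrt : ℕ → ℕ
ceilHalfOnePlusSqrt N = (2 + ceilSqrt N) / 2

strengthBound : (G : Graph) {k : ℕ} → Coloring G k → ℕ
strengthBound G {k} c =
  (ceilHalfOnePlusSqrt (1 + 8 * (colorSum G c ∸ n G)) ∸ 1) ⊔ k

-- Let Y be an optimal colouring with the least number s of colours. Every colour class of
-- Y is nonempty, for an empty one could be squeezed out without raising any colour. Hence
-- Σ(Y) = Σᵢ (|Yᵢ| + (i-1)|Yᵢ|) ≥ n + (0 + 1 + … + (s-1)) = n + s(s-1)/2, while Σ(Y) ≤ Σ(X).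
-- If s(s-1)/2 < Σ(X) - n, then (2s-1)² = 1 + 4s(s-1) < 1 + 8(Σ(X) - n), which is the first
-- term of the bound. Otherwise Σ(X) = n + s(s-1)/2 ≤ Σ(Y), so X is optimal and s ≤ |X|.
module Submission where

open import Defs
open import Data.Nat using (ℕ; zero; suc; _+_; _*_; _∸_; _≤_; _<_; z≤n; s≤s; _≤?_; >-nonZero)
open import Data.Nat.Properties
  using ( +-*-semiring; module ≤-Reasoning; ≤-reflexive; ≤-trans; n≤1+n; 1+n≰n; ≰⇒>; <⇒≱
        ; +-comm; +-suc; +-identityʳ; *-identityˡ; *-identityʳ; *-zeroʳ; *-distribˡ-+
        ; +-mono-≤; +-monoʳ-≤; *-mono-≤; *-monoʳ-<; ∸-monoˡ-≤; m≤m*n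
        ; m≤n⇒m<n∨m≡n; m≤n⇒m≤n⊔o; m≤n⇒m≤o⊔n; m+n≤o⇒m≤o; m+n≤o⇒m≤o∸n; m+[n∸m]≡n )
open import Data.Nat.DivMod using (_/_; /-monoˡ-≤; m*n/n≡m)
open import Data.Nat.Tactic.RingSolver using (solve-∀)
open import Data.Fin as Fin using (Fin; toℕ; punchOut; inject₁; fromℕ; _≟_)
open import Data.Fin.Properties using (any?; punchOut-injective; toℕ-inject₁; toℕ-fromℕ)
open import Data.List using (length; filter; tabulate; foldr)
open import Data.List.Properties using (map-tabulate)
open import Data.List.Membership.Propositional.Properties using (∈-length; ∈-filter⁺; ∈-allFin)
open import Data.Product using (∃; _,_; proj₁; proj₂)
open import Data.Sum using (_⊎_; inj₁; inj₂; [_,_]′)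
open import Data.Empty using (⊥-elim)
open import Data.Bool using (true; false; if_then_else_)
open import Function using (_∘_)
open import Relation.Nullary using (Dec; yes; no; does; _because_)
open import Relation.Unary using (Pred; Decidable)
open import Relation.Binary.PropositionalEquality
open import Algebra.Properties.Semiring.Sum +-*-semiring
  using (sum-syntax; sum-cong-≗; ∑-comm; *-distribˡ-sum; sum-replicate-zero; sum-init-last; ∑-distrib-+)

-- Defined through 'does' rather than by matching on the Dec, so that
-- indicator (suc i ≟ suc j) reduces to indicator (i ≟ j).
indicator : ∀ {p} {P : Set p} → Dec P → ℕ
indicator d = if does d then 1 else 0

∑-mono-≤ : ∀ {k} {f g : Fin k → ℕ} → (∀ i → f i ≤ g i) → ∑[ i < k ] f i ≤ ∑[ i < k ] g i
∑-mono-≤ {zero}  f≤g = z≤n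
∑-mono-≤ {suc k} f≤g = +-mono-≤ (f≤g Fin.zero) (∑-mono-≤ (f≤g ∘ Fin.suc))

∑-const : ∀ k x → ∑[ i < k ] x ≡ k * x
∑-const zero    x = refl
∑-const (suc k) x = cong (x +_) (∑-const k x)

foldr-+-tabulate : ∀ {k} (f : Fin k → ℕ) → foldr _+_ 0 (tabulate f) ≡ ∑[ i < k ] f i
foldr-+-tabulate {zero}  f = refl
foldr-+-tabulate {suc k} f = cong (f Fin.zero +_) (foldr-+-tabulate (f ∘ Fin.suc))

length-filter-tabulate : ∀ {a p k} {A : Set a} {P : Pred A p} (P? : Decidable P) (f : Fin k → A) →
  length (filter P? (tabulate f)) ≡ ∑[ i < k ] indicator (P? (f i))
length-filter-tabulate {k = zero}  P? f = refl
length-filter-tabulate {k = suc k} P? f with P? (f Fin.zero)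
... | true  because _ = cong suc (length-filter-tabulate P? (f ∘ Fin.suc))
... | false because _ = length-filter-tabulate P? (f ∘ Fin.suc)

∑-*-indicator : ∀ {k} (w : Fin k → ℕ) (j : Fin k) → ∑[ i < k ] (w i * indicator (j ≟ i)) ≡ w j
∑-*-indicator {suc k} w Fin.zero = begin
  w Fin.zero * 1 + ∑[ i < k ] (w (Fin.suc i) * 0)  ≡⟨ cong₂ _+_ (*-identityʳ _) (sum-cong-≗ (*-zeroʳ ∘ w ∘ Fin.suc)) ⟩
  w Fin.zero + ∑[ i < k ] 0                        ≡⟨ cong (w Fin.zero +_) (sum-replicate-zero k) ⟩
  w Fin.zero + 0                                   ≡⟨ +-identityʳ _ ⟩
  w Fin.zero                                       ∎
  where open ≡-Reasoning
∑-*-indicator {suc k} w (Fin.suc j) = begin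
  w Fin.zero * 0 + rest  ≡⟨ cong (_+ rest) (*-zeroʳ (w Fin.zero)) ⟩
  rest                   ≡⟨ ∑-*-indicator (w ∘ Fin.suc) j ⟩
  w (Fin.suc j)          ∎
  where
  open ≡-Reasoning
  rest : ℕ
  rest = ∑[ i < k ] (w (Fin.suc i) * indicator (j ≟ i))

module _ (G : Graph) {k : ℕ} (c : Coloring G k) where

  classSize≡∑indicator : ∀ i → classSize G c i ≡ ∑[ v < n G ] indicator (c v ≟ i)
  classSize≡∑indicator i = length-filter-tabulate {P = λ v → c v ≡ i} (λ v → c v ≟ i) (λ v → v)

  ∑-*-classSize : ∀ (w : Fin k → ℕ) → ∑[ i < k ] (w i * classSize G c i) ≡ ∑[ v < n G ] w (c v)
  ∑-*-classSize w = begin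
    ∑[ i < k ] (w i * classSize G c i)                     ≡⟨ sum-cong-≗ (λ i → cong (w i *_) (classSize≡∑indicator i)) ⟩
    ∑[ i < k ] (w i * ∑[ v < n G ] indicator (c v ≟ i))    ≡⟨ sum-cong-≗ (λ i → *-distribˡ-sum (w i) (λ v → indicator (c v ≟ i))) ⟩
    ∑[ i < k ] ∑[ v < n G ] (w i * indicator (c v ≟ i))    ≡⟨ ∑-comm (λ i v → w i * indicator (c v ≟ i)) ⟩
    ∑[ v < n G ] ∑[ i < k ] (w i * indicator (c v ≟ i))    ≡⟨ sum-cong-≗ (λ v → ∑-*-indicator w (c v)) ⟩
    ∑[ v < n G ] w (c v)                                   ∎
    where open ≡-Reasoning

  ∑-classSize : ∑[ i < k ] classSize G c i ≡ n G
  ∑-classSize = begin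
    ∑[ i < k ] classSize G c i        ≡⟨ sum-cong-≗ (λ i → sym (*-identityˡ (classSize G c i))) ⟩
    ∑[ i < k ] (1 * classSize G c i)  ≡⟨ ∑-*-classSize (λ _ → 1) ⟩
    ∑[ v < n G ] 1                    ≡⟨ ∑-const (n G) 1 ⟩
    n G * 1                           ≡⟨ *-identityʳ (n G) ⟩
    n G                               ∎
    where open ≡-Reasoning

  colorSum≡∑classes : colorSum G c ≡ ∑[ i < k ] (suc (toℕ i) * classSize G c i)
  colorSum≡∑classes = trans (cong (foldr _+_ 0) (map-tabulate (λ i → i) weight)) (foldr-+-tabulate weight)
    where
    weight : Fin k → ℕ
    weight i = suc (toℕ i) * classSize G c i

  colorSum≡∑vertices : colorSum G c ≡ ∑[ v < n G ] suc (toℕ (c v))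
  colorSum≡∑vertices = trans colorSum≡∑classes (∑-*-classSize (suc ∘ toℕ))

colorSum-mono : ∀ (G : Graph) {k k′} (c : Coloring G k) (c′ : Coloring G k′) →
  (∀ v → toℕ (c′ v) ≤ toℕ (c v)) → colorSum G c′ ≤ colorSum G c
colorSum-mono G c c′ c′≤c = begin
  colorSum G c′                    ≡⟨ colorSum≡∑vertices G c′ ⟩
  ∑[ v < n G ] suc (toℕ (c′ v))    ≤⟨ ∑-mono-≤ (s≤s ∘ c′≤c) ⟩
  ∑[ v < n G ] suc (toℕ (c v))     ≡⟨ colorSum≡∑vertices G c ⟨
  colorSum G c                     ∎
  where open ≤-Reasoning

toℕ-punchOut-≤ : ∀ {k} {i j : Fin (suc k)} (i≢j : i ≢ j) → toℕ (punchOut i≢j) ≤ toℕ j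
toℕ-punchOut-≤ {_}     {Fin.zero}  {Fin.zero}  i≢j = ⊥-elim (i≢j refl)
toℕ-punchOut-≤ {_}     {Fin.zero}  {Fin.suc j} _   = n≤1+n (toℕ j)
toℕ-punchOut-≤ {suc _} {Fin.suc i} {Fin.zero}  _   = z≤n
toℕ-punchOut-≤ {suc _} {Fin.suc i} {Fin.suc j} i≢j = s≤s (toℕ-punchOut-≤ (i≢j ∘ cong Fin.suc))

optimal-≤ : ∀ (G : Graph) {k k′} {c : Coloring G k} {c′ : Coloring G k′} →
  Optimal G c → Valid G c′ → colorSum G c′ ≤ colorSum G c → Optimal G c′
optimal-≤ G (_ , c-least) c′-valid c′≤c = c′-valid , λ k″ c″ c″-valid → ≤-trans c′≤c (c-least k″ c″ c″-valid)

-- An empty class i is squeezed out by punchOut i, which lowers no colour and keeps the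
-- colouring valid and optimal, but uses one colour fewer.
fewestColours⇒classInhabited : ∀ (G : Graph) {s} (c : Coloring G s) → Optimal G c →
  (∀ k (c′ : Coloring G k) → Optimal G c′ → s ≤ k) → ∀ i → ∃ λ v → c v ≡ i
fewestColours⇒classInhabited G {suc s} c c-optimal c-fewest i with any? (λ v → c v ≟ i)
... | yes inhabited = inhabited
... | no empty = ⊥-elim (1+n≰n (c-fewest s c′ c′-optimal))
  where
  i≢c : ∀ v → i ≢ c v
  i≢c v i≡cv = empty (v , sym i≡cv)

  c′ : Coloring G s
  c′ v = punchOut (i≢c v)

  c′-valid : Valid G c′
  c′-valid u v uv c′u≡c′v = proj₁ c-optimal u v uv (punchOut-injective (i≢c u) (i≢c v) c′u≡c′v)

  c′-optimal : Optimal G c′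
  c′-optimal = optimal-≤ G c-optimal c′-valid (colorSum-mono G c c′ (toℕ-punchOut-≤ ∘ i≢c))

triangular : ℕ → ℕ
triangular k = ∑[ i < k ] toℕ i

classInhabited⇒colorSum-≥ : ∀ (G : Graph) {k} (c : Coloring G k) → (∀ i → ∃ λ v → c v ≡ i) →
  n G + triangular k ≤ colorSum G c
classInhabited⇒colorSum-≥ G {k} c inhabited = begin
  n G + triangular k                                                 ≡⟨ cong (_+ triangular k) (∑-classSize G c) ⟨
  ∑[ i < k ] classSize G c i + ∑[ i < k ] toℕ i                      ≤⟨ +-monoʳ-≤ _ (∑-mono-≤ toℕ≤toℕ*classSize) ⟩
  ∑[ i < k ] classSize G c i + ∑[ i < k ] (toℕ i * classSize G c i)  ≡⟨ ∑-distrib-+ (classSize G c) (λ i → toℕ i * classSize G c i) ⟨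
  ∑[ i < k ] (suc (toℕ i) * classSize G c i)                         ≡⟨ colorSum≡∑classes G c ⟨
  colorSum G c                                                       ∎
  where
  open ≤-Reasoning
  classSize-positive : ∀ i → 0 < classSize G c i
  classSize-positive i with inhabited i
  ... | v , cv≡i = ∈-length (∈-filter⁺ (λ u → c u ≟ i) (∈-allFin v) cv≡i)
  toℕ≤toℕ*classSize : ∀ i → toℕ i ≤ toℕ i * classSize G c i
  toℕ≤toℕ*classSize i = m≤m*n (toℕ i) (classSize G c i) {{>-nonZero (classSize-positive i)}}

triangular-suc : ∀ m → triangular (suc m) ≡ triangular m + m
triangular-suc m = begin
  ∑[ i < suc m ] toℕ i                        ≡⟨ sum-init-last {m} toℕ ⟩
  ∑[ i < m ] toℕ (inject₁ i) + toℕ (fromℕ m)  ≡⟨ cong₂ _+_ (sum-cong-≗ {m} toℕ-inject₁) (toℕ-fromℕ m) ⟩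
  ∑[ i < m ] toℕ i + m                        ∎
  where open ≡-Reasoning

[1+2m]²≡1+8*triangular[1+m] : ∀ m → (1 + 2 * m) * (1 + 2 * m) ≡ 1 + 8 * triangular (suc m)
[1+2m]²≡1+8*triangular[1+m] zero    = refl
[1+2m]²≡1+8*triangular[1+m] (suc m) = begin
  (1 + 2 * suc m) * (1 + 2 * suc m)             ≡⟨ square-step m ⟩
  (1 + 2 * m) * (1 + 2 * m) + 8 * suc m         ≡⟨ cong (_+ 8 * suc m) ([1+2m]²≡1+8*triangular[1+m] m) ⟩
  1 + 8 * triangular (suc m) + 8 * suc m        ≡⟨ cong suc (*-distribˡ-+ 8 (triangular (suc m)) (suc m)) ⟨
  1 + 8 * (triangular (suc m) + suc m)          ≡⟨ cong (λ t → 1 + 8 * t) (triangular-suc (suc m)) ⟨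
  1 + 8 * triangular (suc (suc m))              ∎
  where
  open ≡-Reasoning
  square-step : ∀ m → (1 + 2 * suc m) * (1 + 2 * suc m) ≡ (1 + 2 * m) * (1 + 2 * m) + 8 * suc m
  square-step = solve-∀

ceilSqrtFrom-spec : ∀ N r f → N ≤ ceilSqrtFrom N r f * ceilSqrtFrom N r f ⊎ ceilSqrtFrom N r f ≡ r + f
ceilSqrtFrom-spec N r zero = inj₂ (sym (+-identityʳ r))
ceilSqrtFrom-spec N r (suc f) with N ≤? r * r
... | yes N≤r*r = inj₁ N≤r*r
... | no _ with ceilSqrtFrom-spec N (suc r) f
...   | inj₁ N≤square = inj₁ N≤square
...   | inj₂ ≡1+r+f   = inj₂ (trans ≡1+r+f (sym (+-suc r f)))

n≤ceilSqrt[n]² : ∀ N → N ≤ ceilSqrt N * ceilSqrt N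
n≤ceilSqrt[n]² N with ceilSqrtFrom-spec N 0 N
... | inj₁ N≤square = N≤square
... | inj₂ ≡N rewrite ≡N = n≤n*n N
  where
  n≤n*n : ∀ n → n ≤ n * n
  n≤n*n zero    = z≤n
  n≤n*n (suc n) = m≤m*n (suc n) (suc n)

m*m<n⇒m<ceilSqrt[n] : ∀ {m N} → m * m < N → m < ceilSqrt N
m*m<n⇒m<ceilSqrt[n] {m} {N} m*m<N =
  ≰⇒> λ ceilSqrt≤m → <⇒≱ m*m<N (≤-trans (n≤ceilSqrt[n]² N) (*-mono-≤ ceilSqrt≤m ceilSqrt≤m))

triangular<⇒≤ceilHalfOnePlusSqrt∸1 : ∀ s D → triangular s < D → s ≤ ceilHalfOnePlusSqrt (1 + 8 * D) ∸ 1
triangular<⇒≤ceilHalfOnePlusSqrt∸1 zero    D _   = z≤n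
triangular<⇒≤ceilHalfOnePlusSqrt∸1 (suc s) D T<D = ∸-monoˡ-≤ 1 (begin
  2 + s                         ≡⟨ m*n/n≡m (2 + s) 2 ⟨
  (2 + s) * 2 / 2               ≤⟨ /-monoˡ-≤ 2 (≤-trans (≤-reflexive (double s)) (+-monoʳ-≤ 2 2+2s≤ceilSqrt)) ⟩
  (2 + ceilSqrt (1 + 8 * D)) / 2  ∎)
  where
  open ≤-Reasoning
  2+2s≤ceilSqrt : 2 + 2 * s ≤ ceilSqrt (1 + 8 * D)
  2+2s≤ceilSqrt = m*m<n⇒m<ceilSqrt[n] (begin-strict
    (1 + 2 * s) * (1 + 2 * s)  ≡⟨ [1+2m]²≡1+8*triangular[1+m] s ⟩
    1 + 8 * triangular (suc s) <⟨ s≤s (*-monoʳ-< 8 T<D) ⟩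
    1 + 8 * D                  ∎)
  double : ∀ s → (2 + s) * 2 ≡ 2 + (2 + 2 * s)
  double = solve-∀

mainTheorem1 : (G : Graph) (k : ℕ) (c : Coloring G k) → Valid G c →
    (s : ℕ) → IsChromaticStrength G s → s ≤ strengthBound G c
mainTheorem1 G k c c-valid s ((Y , Y-optimal) , Y-fewest) =
  [ (λ T<D → m≤n⇒m≤n⊔o k (triangular<⇒≤ceilHalfOnePlusSqrt∸1 s D T<D))
  , (λ T≡D → m≤n⇒m≤o⊔n _ (Y-fewest k c (optimal-≤ G Y-optimal c-valid (c≤Y T≡D))))
  ]′ (m≤n⇒m<n∨m≡n T≤D)
  where
  D : ℕ
  D = colorSum G c ∸ n G

  n+T≤Y : n G + triangular s ≤ colorSum G Y
  n+T≤Y = classInhabited⇒colorSum-≥ G Y (fewestColours⇒classInhabited G Y Y-optimal Y-fewest)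

  n+T≤c : n G + triangular s ≤ colorSum G c
  n+T≤c = ≤-trans n+T≤Y (proj₂ Y-optimal k c c-valid)

  T≤D : triangular s ≤ D
  T≤D = m+n≤o⇒m≤o∸n (triangular s) (subst (_≤ colorSum G c) (+-comm (n G) (triangular s)) n+T≤c)

  c≤Y : triangular s ≡ D → colorSum G c ≤ colorSum G Y
  c≤Y T≡D = begin
    colorSum G c        ≡⟨ m+[n∸m]≡n (m+n≤o⇒m≤o (n G) n+T≤c) ⟨
    n G + D             ≡⟨ cong (n G +_) T≡D ⟨
    n G + triangular s  ≤⟨ n+T≤Y ⟩
    colorSum G Y        ∎
    where open ≤-Reasoning
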